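{- Let $k\ge 2$ be an integer and let $W_n$ be the wheel graph with $n\ge 3k$. Then $$b_t^{k-1}(W_n)=k.$$
   Context: The wheel $W_n$ is the graph on $n+1$ vertices obtained by joining a single vertex to every vertex of a cycle $C_n$. A total dominating set of a graph without isolated vertices is a vertex set $S$ such that every vertex is adjacent to some vertex of $S$; $\gamma_t(G)$ is the minimum size of such a set. The $k$-total bondage number $b_t^k(G)$ (for $k\ge1$) is the minimum number of edges that must be deleted from $G$ so that the resulting graph (required to have no isolated vertices) has total domination number at least $\gamma_t(G)+k$. -}

module Defs where

open import Data.Nat using (ℕ; zero; suc; _+_; _≤_)
open import Data.Nat.DivMod using (_mod_)
open import Data.Fin using (Fin; zero; suc; toℕ; splitAt)
open import Data.Fin.Subset using (Subset; _∈_; _∉_; ∣_∣; ⊥)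
open import Data.Product using (Σ; ∃; _×_; _,_)
open import Data.Sum using (_⊎_; inj₁; inj₂)
open import Relation.Binary.PropositionalEquality using (_≡_)

record Graph : Set where
  field
    V : ℕ
    E : ℕ
    ends : Fin E → Fin V × Fin V
open Graph public

-- Spanning subgraph G - D obtained by deleting the edge set D ⊆ E(G).
-- Adjacency of u and v in G - D.
Adj : (G : Graph) → Subset (E G) → Fin (V G) → Fin (V G) → Set
Adj G D u v = ∃ λ e → e ∉ D × (ends G e ≡ (u , v) ⊎ ends G e ≡ (v , u))

NoIsolated : (G : Graph) → Subset (E G) → Set
NoIsolated G D = ∀ v → ∃ λ u → Adj G D v u

TotalDominating : (G : Graph) → Subset (E G) → Subset (V G) → Set
TotalDominating G D S = ∀ v → ∃ λ u → u ∈ S × Adj G D v u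

IsTotalDomNumber : (G : Graph) → Subset (E G) → ℕ → Set
IsTotalDomNumber G D g =
  (Σ (Subset (V G)) λ S → TotalDominating G D S × ∣ S ∣ ≡ g)
  × (∀ S → TotalDominating G D S → g ≤ ∣ S ∣)

TotalDomAtLeast : (G : Graph) → Subset (E G) → ℕ → Set
TotalDomAtLeast G D m = ∀ S → TotalDominating G D S → m ≤ ∣ S ∣

IsKTotalBondage : (G : Graph) → ℕ → ℕ → Set
IsKTotalBondage G k b =
  Σ ℕ λ g → IsTotalDomNumber G ⊥ g
    × (Σ (Subset (E G)) λ D → ∣ D ∣ ≡ b × NoIsolated G D × TotalDomAtLeast G D (g + k))
    × (∀ D → NoIsolated G D → TotalDomAtLeast G D (g + k) → b ≤ ∣ D ∣)

cycNext : ∀ {n} → Fin n → Fin n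
cycNext {suc n} i = suc (toℕ i) mod suc n

-- Wheel W_n: vertex 0 is the hub, vertex suc i (i : Fin n) is rim vertex i.
-- Edges 0..n-1 are the spokes {hub, i}; edges n..2n-1 are the rim edges {i, i+1 mod n}.
wheelEnds : (n : ℕ) → Fin (n + n) → Fin (suc n) × Fin (suc n)
wheelEnds n e with splitAt n e
... | inj₁ i = zero , suc i
... | inj₂ i = suc i , suc (cycNext i)

wheel : ℕ → Graph
wheel n = record { V = suc n ; E = n + n ; ends = wheelEnds n }

-- γ_t(W_n) = 2, witnessed by the hub and any rim vertex.
-- Deleting the k spokes at the rim vertices 0, 3, …, 3(k − 1) raises γ_t to at least k + 1:
-- a total dominating set containing the hub must dominate each of these vertices through a
-- rim neighbour, and no rim vertex serves two of them since they lie three apart; a set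
-- avoiding the hub dominates every rim vertex by one of its rim vertices, each covering at
-- most two, so it has at least n/2 ≥ 3k/2 > k elements.
-- Conversely, after deleting a set D of at most k − 1 edges that isolates no vertex, the hub
-- together with one suitably chosen vertex per deleted edge (or, if no spoke is deleted, the
-- hub and a single rim vertex) is still total dominating, so γ_t ≤ max(2, |D| + 1) ≤ k.
module Submission where

open import Data.Empty using (⊥-elim)
open import Data.Fin using (Fin; zero; suc; toℕ; fromℕ<; _↑ˡ_; _↑ʳ_; splitAt; join)
open import Data.Fin.Properties
  using (toℕ-injective; toℕ-fromℕ<; 0≢1+n; toℕ<n; fromℕ<-toℕ; suc-injective; ↑ˡ-injective;
         splitAt-↑ˡ; splitAt-↑ʳ; splitAt⁻¹-↑ˡ; splitAt⁻¹-↑ʳ; splitAt-join; any?; ¬∀⟶∃¬)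
open import Data.Fin.Subset using (Subset; _∈_; _∉_; ∣_∣; ⊥; ⁅_⁆; _∪_; _-_; inside; outside)
open import Data.Fin.Subset.Properties
  using (x∈p⇒∣p-x∣<∣p∣; x∈p∧x≢y⇒x∈p-y; _∈?_; ∉⊥; ∣⊥∣≡0; ∣⁅x⁆∣≡1; x∈⁅x⁆; p⊆p∪q; q⊆p∪q)
open import Data.Nat using (ℕ; zero; suc; _+_; _*_; _∸_; _≤_; _<_; _⊔_; z≤n; s≤s; s≤s⁻¹)
open import Data.Nat.Properties
  using (≤-reflexive; ≤-trans; ≤-<-trans; <-≤-trans; ≤-antisym; <⇒≤; <⇒≢; <⇒≱; ≰⇒>; ≮⇒≥;
         1+n≢0; 1+n≢n; n≤1+n; m<n⇒m<1+n; m<1+n⇒m<n∨m≡n; m<m+n; m<m*n; m+[n∸m]≡n; m+n≤o⇒n≤o;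
         +-suc; +-identityʳ; +-mono-≤; +-monoʳ-≤; +-monoʳ-<; *-comm; *-monoˡ-≤; *-cancelʳ-≡;
         m≤m⊔n; m≤n⊔m; ⊔-lub)
import Data.Nat.Properties as ℕ
open import Data.Nat.DivMod using (_%_; m<n⇒m%n≡m; n%n≡0; [m+kn]%n≡m%n; m*n%n≡0)
open import Data.Product using (∃; _×_; _,_; proj₁; proj₂)
open import Data.Sum using (_⊎_; inj₁; inj₂; [_,_]′)
open import Data.Vec using (_∷_; []; _++_; here; there)
open import Data.Vec.Properties using (lookup-++ˡ; lookup-++ʳ; []=⇒lookup; lookup⇒[]=)
open import Function using (_∘_)
open import Function.Definitions using (Injective)
open import Relation.Binary.PropositionalEquality
  using (_≡_; _≢_; refl; sym; trans; cong; cong₂; subst; module ≡-Reasoning)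
open import Relation.Nullary using (¬_; yes; no)
open import Relation.Nullary.Decidable using (_×-dec_; ¬?; decidable-stable)
open import Relation.Unary using (Decidable)

open import Defs

-- The cycle ℤ/(m+1)

toℕ-cycNext-< : ∀ {m} (i : Fin (suc m)) → toℕ i < m → toℕ (cycNext i) ≡ suc (toℕ i)
toℕ-cycNext-< i i<m = trans (toℕ-fromℕ< _) (m<n⇒m%n≡m (s≤s i<m))

toℕ-cycNext-last : ∀ {m} (i : Fin (suc m)) → toℕ i ≡ m → toℕ (cycNext i) ≡ 0
toℕ-cycNext-last {m} i i≡m =
  trans (toℕ-fromℕ< _) (trans (cong (λ t → suc t % suc m) i≡m) (n%n≡0 (suc m)))

cycNext-fromℕ< : ∀ {m t} (t<m : t < m) → cycNext (fromℕ< (m<n⇒m<1+n t<m)) ≡ fromℕ< (s≤s t<m)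
cycNext-fromℕ< {m} {t} t<m = toℕ-injective (begin
  toℕ (cycNext i)          ≡⟨ toℕ-cycNext-< i (subst (_< m) (sym (toℕ-fromℕ< (m<n⇒m<1+n t<m))) t<m) ⟩
  suc (toℕ i)              ≡⟨ cong suc (toℕ-fromℕ< (m<n⇒m<1+n t<m)) ⟩
  suc t                    ≡⟨ toℕ-fromℕ< (s≤s t<m) ⟨
  toℕ (fromℕ< (s≤s t<m))   ∎)
  where
  open ≡-Reasoning
  i : Fin (suc m)
  i = fromℕ< (m<n⇒m<1+n t<m)

cycNext-injective : ∀ {m} → Injective _≡_ _≡_ (cycNext {suc m})
cycNext-injective {x = i} {y = j} eq
  with m<1+n⇒m<n∨m≡n (toℕ<n i) | m<1+n⇒m<n∨m≡n (toℕ<n j)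
... | inj₁ i<m | inj₁ j<m = toℕ-injective (ℕ.suc-injective
  (trans (sym (toℕ-cycNext-< i i<m)) (trans (cong toℕ eq) (toℕ-cycNext-< j j<m))))
... | inj₁ i<m | inj₂ j≡m
  with () ← trans (sym (toℕ-cycNext-< i i<m)) (trans (cong toℕ eq) (toℕ-cycNext-last j j≡m))
... | inj₂ i≡m | inj₁ j<m
  with () ← trans (sym (toℕ-cycNext-last i i≡m)) (trans (cong toℕ eq) (toℕ-cycNext-< j j<m))
... | inj₂ i≡m | inj₂ j≡m = toℕ-injective (trans i≡m (sym j≡m))

cycNext-irreflexive : ∀ {m} → 1 ≤ m → (i : Fin (suc m)) → cycNext i ≢ i
cycNext-irreflexive 1≤m i eq with m<1+n⇒m<n∨m≡n (toℕ<n i)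
... | inj₁ i<m = 1+n≢n (trans (sym (toℕ-cycNext-< i i<m)) (cong toℕ eq))
... | inj₂ i≡m = <⇒≢ 1≤m (trans (sym (toℕ-cycNext-last i i≡m)) (trans (cong toℕ eq) i≡m))

cycNext-closed⇒all : ∀ {m} (P : Fin (suc m) → Set) → (∀ v → P v → P (cycNext v)) →
                     ∀ {v} → P v → ∀ j → P j
cycNext-closed⇒all {m} P step {v} Pv j =
  subst P (fromℕ<-toℕ j (toℕ<n j)) (upFromZero (toℕ j) (toℕ<n j))
  where
  toZero : ∀ d (i : Fin (suc m)) → toℕ i + d ≡ m → P i → P zero
  toZero zero i i+0≡m Pi =
    subst P (toℕ-injective (toℕ-cycNext-last i (trans (sym (+-identityʳ (toℕ i))) i+0≡m))) (step i Pi)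
  toZero (suc d) i i+d≡m Pi = toZero d (cycNext i) next+d≡m (step i Pi)
    where
    i<m : toℕ i < m
    i<m = subst (toℕ i <_) i+d≡m (m<m+n (toℕ i) (s≤s z≤n))
    next+d≡m : toℕ (cycNext i) + d ≡ m
    next+d≡m = trans (cong (_+ d) (toℕ-cycNext-< i i<m)) (trans (sym (+-suc (toℕ i) d)) i+d≡m)
  upFromZero : ∀ t (t<n : t < suc m) → P (fromℕ< t<n)
  upFromZero zero _ = toZero (m ∸ toℕ v) v (m+[n∸m]≡n (s≤s⁻¹ (toℕ<n v))) Pv
  upFromZero (suc t) t+1<n =
    subst P (cycNext-fromℕ< (s≤s⁻¹ t+1<n)) (step _ (upFromZero t (m<n⇒m<1+n (s≤s⁻¹ t+1<n))))

cycle-boundary : ∀ {m} {P : Fin (suc m) → Set} → Decidable P →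
                 ∀ {a x} → P a → ¬ P x → ∃ λ v → P v × ¬ P (cycNext v)
cycle-boundary {P = P} P? Pa ¬Px with any? (λ v → P? v ×-dec ¬? (P? (cycNext v)))
... | yes boundary = boundary
... | no noBoundary = ⊥-elim (¬Px (cycNext-closed⇒all P step Pa _))
  where
  step : ∀ v → P v → P (cycNext v)
  step v Pv = decidable-stable (P? (cycNext v)) (λ ¬Pnext → noBoundary (v , Pv , ¬Pnext))

CycAdj : ∀ {n} → Fin n → Fin n → Set
CycAdj u v = cycNext u ≡ v ⊎ cycNext v ≡ u

common-neighbour : ∀ {m} {a b u : Fin (suc m)} → CycAdj a u → CycAdj b u →
                   a ≡ b ⊎ cycNext (cycNext a) ≡ b ⊎ cycNext (cycNext b) ≡ a
common-neighbour (inj₁ au) (inj₁ bu) = inj₁ (cycNext-injective (trans au (sym bu)))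
common-neighbour (inj₂ ua) (inj₂ ub) = inj₁ (trans (sym ua) ub)
common-neighbour (inj₁ refl) (inj₂ ub) = inj₂ (inj₁ ub)
common-neighbour (inj₂ ua) (inj₁ refl) = inj₂ (inj₂ ua)

-- Counting elements of subsets

injective⇒≤∣p∣ : ∀ {m n} {p : Subset n} {f : Fin m → Fin n} →
                 Injective _≡_ _≡_ f → (∀ i → f i ∈ p) → m ≤ ∣ p ∣
injective⇒≤∣p∣ {zero} _ _ = z≤n
injective⇒≤∣p∣ {suc m} {p = p} {f} f-inj f∈p =
  ≤-trans (s≤s (injective⇒≤∣p∣ (suc-injective ∘ f-inj) f∘suc∈p-f0)) (x∈p⇒∣p-x∣<∣p∣ (f∈p zero))
  where
  f∘suc∈p-f0 : ∀ i → f (suc i) ∈ p - f zero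
  f∘suc∈p-f0 i = x∈p∧x≢y⇒x∈p-y (f∈p (suc i)) (0≢1+n ∘ sym ∘ f-inj)

two-elements⇒2≤∣p∣ : ∀ {n} {p : Subset n} {x y} → x ∈ p → y ∈ p → x ≢ y → 2 ≤ ∣ p ∣
two-elements⇒2≤∣p∣ x∈p y∈p x≢y =
  ≤-trans (s≤s (≤-<-trans z≤n (x∈p⇒∣p-x∣<∣p∣ (x∈p∧x≢y⇒x∈p-y y∈p (x≢y ∘ sym)))))
          (x∈p⇒∣p-x∣<∣p∣ x∈p)

∣p∪q∣≤∣p∣+∣q∣ : ∀ {n} (p q : Subset n) → ∣ p ∪ q ∣ ≤ ∣ p ∣ + ∣ q ∣
∣p∪q∣≤∣p∣+∣q∣ [] [] = z≤n
∣p∪q∣≤∣p∣+∣q∣ (inside ∷ p) (inside ∷ q) =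
  s≤s (≤-trans (∣p∪q∣≤∣p∣+∣q∣ p q) (+-monoʳ-≤ ∣ p ∣ (n≤1+n _)))
∣p∪q∣≤∣p∣+∣q∣ (inside ∷ p) (outside ∷ q) = s≤s (∣p∪q∣≤∣p∣+∣q∣ p q)
∣p∪q∣≤∣p∣+∣q∣ (outside ∷ p) (inside ∷ q) =
  subst (suc ∣ p ∪ q ∣ ≤_) (sym (+-suc ∣ p ∣ ∣ q ∣)) (s≤s (∣p∪q∣≤∣p∣+∣q∣ p q))
∣p∪q∣≤∣p∣+∣q∣ (outside ∷ p) (outside ∷ q) = ∣p∪q∣≤∣p∣+∣q∣ p q

∣⁅x⁆∪p∣≤1+∣p∣ : ∀ {n} (x : Fin n) p → ∣ ⁅ x ⁆ ∪ p ∣ ≤ suc ∣ p ∣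
∣⁅x⁆∪p∣≤1+∣p∣ x p = subst (∣ ⁅ x ⁆ ∪ p ∣ ≤_) (cong (_+ ∣ p ∣) (∣⁅x⁆∣≡1 x)) (∣p∪q∣≤∣p∣+∣q∣ ⁅ x ⁆ p)

∣p++q∣≡∣p∣+∣q∣ : ∀ {a b} (p : Subset a) (q : Subset b) → ∣ p ++ q ∣ ≡ ∣ p ∣ + ∣ q ∣
∣p++q∣≡∣p∣+∣q∣ [] q = refl
∣p++q∣≡∣p∣+∣q∣ (inside ∷ p) q = cong suc (∣p++q∣≡∣p∣+∣q∣ p q)
∣p++q∣≡∣p∣+∣q∣ (outside ∷ p) q = ∣p++q∣≡∣p∣+∣q∣ p q

x∈p⇒x↑ˡ∈p++q : ∀ {a b} {p : Subset a} (q : Subset b) {x} → x ∈ p → x ↑ˡ b ∈ p ++ q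
x∈p⇒x↑ˡ∈p++q {p = p} q {x} x∈p = lookup⇒[]= _ _ (trans (lookup-++ˡ p q x) ([]=⇒lookup x∈p))

y∈q⇒a↑ʳy∈p++q : ∀ {a b} (p : Subset a) {q : Subset b} {y} → y ∈ q → a ↑ʳ y ∈ p ++ q
y∈q⇒a↑ʳy∈p++q p {q} {y} y∈q = lookup⇒[]= _ _ (trans (lookup-++ʳ p q y) ([]=⇒lookup y∈q))

a↑ʳy∈p++q⇒y∈q : ∀ {a b} (p : Subset a) {q : Subset b} {y} → a ↑ʳ y ∈ p ++ q → y ∈ q
a↑ʳy∈p++q⇒y∈q p {q} {y} h = lookup⇒[]= _ _ (trans (sym (lookup-++ʳ p q y)) ([]=⇒lookup h))

image : ∀ {a b} → (Fin a → Fin b) → Subset a → Subset b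
image f [] = ⊥
image f (inside ∷ p) = ⁅ f zero ⁆ ∪ image (f ∘ suc) p
image f (outside ∷ p) = image (f ∘ suc) p

x∈p⇒fx∈image : ∀ {a b} (f : Fin a → Fin b) (p : Subset a) {x} → x ∈ p → f x ∈ image f p
x∈p⇒fx∈image f (inside ∷ p) here = p⊆p∪q (image (f ∘ suc) p) (x∈⁅x⁆ (f zero))
x∈p⇒fx∈image f (inside ∷ p) (there x∈p) =
  q⊆p∪q ⁅ f zero ⁆ (image (f ∘ suc) p) (x∈p⇒fx∈image (f ∘ suc) p x∈p)
x∈p⇒fx∈image f (outside ∷ p) (there x∈p) = x∈p⇒fx∈image (f ∘ suc) p x∈p

∣image∣≤∣p∣ : ∀ {a b} (f : Fin a → Fin b) (p : Subset a) → ∣ image f p ∣ ≤ ∣ p ∣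
∣image∣≤∣p∣ {b = b} f [] = ≤-reflexive (∣⊥∣≡0 b)
∣image∣≤∣p∣ f (inside ∷ p) =
  ≤-trans (∣⁅x⁆∪p∣≤1+∣p∣ (f zero) (image (f ∘ suc) p)) (s≤s (∣image∣≤∣p∣ (f ∘ suc) p))
∣image∣≤∣p∣ f (outside ∷ p) = ∣image∣≤∣p∣ (f ∘ suc) p

TotalDomAtMost : (G : Graph) → Subset (E G) → ℕ → Set
TotalDomAtMost G D b = ∃ λ S → TotalDominating G D S × ∣ S ∣ ≤ b

atLeast⇒¬atMost : ∀ {G D b} → TotalDomAtLeast G D (suc b) → ¬ TotalDomAtMost G D b
atLeast⇒¬atMost large (S , S-tds , ∣S∣≤b) = <⇒≱ (large S S-tds) ∣S∣≤b

adj-sym : ∀ {G D u v} → Adj G D u v → Adj G D v u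
adj-sym (e , e∉D , inj₁ eq) = e , e∉D , inj₂ eq
adj-sym (e , e∉D , inj₂ eq) = e , e∉D , inj₁ eq

loopless⇒2≤∣tds∣ : ∀ {G D S} → (∀ x → ¬ Adj G D x x) → Fin (V G) →
                   TotalDominating G D S → 2 ≤ ∣ S ∣
loopless⇒2≤∣tds∣ loopless v S-tds with S-tds v
... | u , u∈S , _ with S-tds u
... | w , w∈S , u~w = two-elements⇒2≤∣p∣ u∈S w∈S (λ { refl → loopless u u~w })

-- Edges and adjacency of the wheel

spoke : ∀ {n} → Fin n → Fin (n + n)
spoke {n} i = i ↑ˡ n

rim : ∀ {n} → Fin n → Fin (n + n)
rim {n} i = n ↑ʳ i

onEdges : ∀ {n} {A : Set} → (Fin n → A) → (Fin n → A) → Fin (n + n) → A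
onEdges {n} f g = [ f , g ]′ ∘ splitAt n

onEdges-spoke : ∀ {n A} (f g : Fin n → A) i → onEdges f g (spoke i) ≡ f i
onEdges-spoke {n} f g i = cong [ f , g ]′ (splitAt-↑ˡ n i n)

onEdges-rim : ∀ {n A} (f g : Fin n → A) i → onEdges f g (rim i) ≡ g i
onEdges-rim {n} f g i = cong [ f , g ]′ (splitAt-↑ʳ n n i)

wheelEnds-spoke : ∀ n (i : Fin n) → wheelEnds n (spoke i) ≡ (zero , suc i)
wheelEnds-spoke n i rewrite splitAt-↑ˡ n i n = refl

wheelEnds-rim : ∀ n (i : Fin n) → wheelEnds n (rim i) ≡ (suc i , suc (cycNext i))
wheelEnds-rim n i rewrite splitAt-↑ʳ n n i = refl

wheelEnds⁻¹ : ∀ {n} e {a b} → wheelEnds n e ≡ (a , b) →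
              (∃ λ i → e ≡ spoke i × a ≡ zero × b ≡ suc i) ⊎
              (∃ λ i → e ≡ rim i × a ≡ suc i × b ≡ suc (cycNext i))
wheelEnds⁻¹ {n} e eq with splitAt n e in split
... | inj₁ i = inj₁ (i , sym (splitAt⁻¹-↑ˡ split) , cong proj₁ (sym eq) , cong proj₂ (sym eq))
... | inj₂ i = inj₂ (i , sym (splitAt⁻¹-↑ʳ split) , cong proj₁ (sym eq) , cong proj₂ (sym eq))

spoke-adj : ∀ {n D} {i : Fin n} → spoke i ∉ D → Adj (wheel n) D zero (suc i)
spoke-adj {n} {i = i} i∉D = spoke i , i∉D , inj₁ (wheelEnds-spoke n i)

rim-adj : ∀ {n D} {i : Fin n} → rim i ∉ D → Adj (wheel n) D (suc i) (suc (cycNext i))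
rim-adj {n} {i = i} i∉D = rim i , i∉D , inj₁ (wheelEnds-rim n i)

hub-adj⇒spoke∉ : ∀ {n D} {v : Fin n} → Adj (wheel n) D zero (suc v) → spoke v ∉ D
hub-adj⇒spoke∉ (e , e∉D , inj₁ eq) with wheelEnds⁻¹ e eq
... | inj₁ (_ , refl , _ , refl) = e∉D
... | inj₂ (_ , _ , () , _)
hub-adj⇒spoke∉ (e , e∉D , inj₂ eq) with wheelEnds⁻¹ e eq
... | inj₁ (_ , _ , () , _)
... | inj₂ (_ , _ , _ , ())

rim-adj⇒CycAdj : ∀ {n D} {u v : Fin n} → Adj (wheel n) D (suc u) (suc v) → CycAdj u v
rim-adj⇒CycAdj (e , _ , inj₁ eq) with wheelEnds⁻¹ e eq
... | inj₁ (_ , _ , () , _)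
... | inj₂ (_ , _ , refl , refl) = inj₁ refl
rim-adj⇒CycAdj (e , _ , inj₂ eq) with wheelEnds⁻¹ e eq
... | inj₁ (_ , _ , () , _)
... | inj₂ (_ , _ , refl , refl) = inj₂ refl

wheel-loopless : ∀ {m D} → 1 ≤ m → (x : Fin (suc (suc m))) → ¬ Adj (wheel (suc m)) D x x
wheel-loopless 1≤m x (e , _ , inj₁ eq) = no-loop-ends 1≤m e eq
  where
  no-loop-ends : ∀ {m x} → 1 ≤ m → ∀ e → ¬ wheelEnds (suc m) e ≡ (x , x)
  no-loop-ends 1≤m e eq with wheelEnds⁻¹ e eq
  ... | inj₁ (_ , _ , refl , ())
  ... | inj₂ (i , _ , refl , i≡next) = cycNext-irreflexive 1≤m i (sym (suc-injective i≡next))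
wheel-loopless 1≤m x (e , e∉D , inj₂ eq) = wheel-loopless 1≤m x (e , e∉D , inj₁ eq)

∣D∣<n⇒spoke∉D : ∀ {n} {D : Subset (n + n)} → ∣ D ∣ < n → ∃ λ x → spoke x ∉ D
∣D∣<n⇒spoke∉D {n} {D} ∣D∣<n = ¬∀⟶∃¬ n (λ x → spoke x ∈ D) (λ x → spoke x ∈? D)
  (λ all∈D → <⇒≱ ∣D∣<n (injective⇒≤∣p∣ (↑ˡ-injective n _ _) all∈D))

rims-intact⇒noIsolated : ∀ {n D} → (∀ i → rim i ∉ D) → ∣ D ∣ < n → NoIsolated (wheel n) D
rims-intact⇒noIsolated _ ∣D∣<n zero with ∣D∣<n⇒spoke∉D ∣D∣<n
... | x , x∉D = suc x , spoke-adj x∉D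
rims-intact⇒noIsolated rims∉D _ (suc i) = suc (cycNext i) , rim-adj (rims∉D i)

spokes-intact⇒γt≤2 : ∀ {n D} → (∀ v → spoke v ∉ D) → Fin n → TotalDomAtMost (wheel n) D 2
spokes-intact⇒γt≤2 {D = D} spokes∉D x =
  ⁅ zero ⁆ ∪ ⁅ suc x ⁆ , S-tds ,
  ≤-trans (∣⁅x⁆∪p∣≤1+∣p∣ zero ⁅ suc x ⁆) (≤-reflexive (cong suc (∣⁅x⁆∣≡1 (suc x))))
  where
  S-tds : TotalDominating (wheel _) D (⁅ zero ⁆ ∪ ⁅ suc x ⁆)
  S-tds zero = suc x , q⊆p∪q ⁅ zero ⁆ ⁅ suc x ⁆ (x∈⁅x⁆ (suc x)) , spoke-adj (spokes∉D x)
  S-tds (suc v) = zero , p⊆p∪q ⁅ suc x ⁆ (x∈⁅x⁆ zero) , adj-sym (spoke-adj (spokes∉D v))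

wheel-γt≡2 : ∀ {m} → 1 ≤ m → IsTotalDomNumber (wheel (suc m)) ⊥ 2
wheel-γt≡2 1≤m with spokes-intact⇒γt≤2 (λ _ → ∉⊥) zero
... | S , S-tds , ∣S∣≤2 = (S , S-tds , ≤-antisym ∣S∣≤2 (2≤∣tds∣ S S-tds)) , 2≤∣tds∣
  where
  2≤∣tds∣ : ∀ S → TotalDominating (wheel _) ⊥ S → 2 ≤ ∣ S ∣
  2≤∣tds∣ S = loopless⇒2≤∣tds∣ (wheel-loopless 1≤m) zero

-- Lower bounds for total dominating sets after deleting spokes

hub∈tds⇒k<∣S∣ : ∀ {m k D S} (r : Fin k → Fin (suc m)) → Injective _≡_ _≡_ r →
                (∀ i j → cycNext (cycNext (r i)) ≢ r j) → (∀ i → spoke (r i) ∈ D) →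
                zero ∈ S → TotalDominating (wheel (suc m)) D S → k < ∣ S ∣
hub∈tds⇒k<∣S∣ {m} {k} {D} {S} r r-injective r-spread r∈D hub∈S S-tds =
  injective⇒≤∣p∣ f-injective f∈S
  where
  rimDominator : (i : Fin k) → ∃ λ u → suc u ∈ S × CycAdj (r i) u
  rimDominator i with S-tds (suc (r i))
  ... | zero , _ , ri~hub = ⊥-elim (hub-adj⇒spoke∉ (adj-sym ri~hub) (r∈D i))
  ... | suc u , u∈S , ri~u = u , u∈S , rim-adj⇒CycAdj ri~u

  dominator : Fin k → Fin (suc m)
  dominator i = proj₁ (rimDominator i)

  dominates : ∀ i → CycAdj (r i) (dominator i)
  dominates i = proj₂ (proj₂ (rimDominator i))

  dominator-injective : Injective _≡_ _≡_ dominator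
  dominator-injective {i} {j} eq
    with common-neighbour (dominates i) (subst (CycAdj (r j)) (sym eq) (dominates j))
  ... | inj₁ ri≡rj = r-injective ri≡rj
  ... | inj₂ (inj₁ two-apart) = ⊥-elim (r-spread i j two-apart)
  ... | inj₂ (inj₂ two-apart) = ⊥-elim (r-spread j i two-apart)

  f : Fin (suc k) → Fin (suc (suc m))
  f zero = zero
  f (suc i) = suc (dominator i)

  f∈S : ∀ i → f i ∈ S
  f∈S zero = hub∈S
  f∈S (suc i) = proj₁ (proj₂ (rimDominator i))

  f-injective : Injective _≡_ _≡_ f
  f-injective {zero} {zero} _ = refl
  f-injective {suc i} {suc j} eq = cong suc (dominator-injective (suc-injective eq))

hub∉tds⇒n≤2∣S∣ : ∀ {m D S} → zero ∉ S → TotalDominating (wheel (suc m)) D S → suc m ≤ ∣ S ∣ + ∣ S ∣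
hub∉tds⇒n≤2∣S∣ {S = inside ∷ _} hub∉S _ = ⊥-elim (hub∉S here)
hub∉tds⇒n≤2∣S∣ {m} {D} {outside ∷ R} _ S-tds =
  subst (suc m ≤_) (∣p++q∣≡∣p∣+∣q∣ R R) (injective⇒≤∣p∣ code-injective code∈R++R)
  where
  rimDominator : (v : Fin (suc m)) → ∃ λ u → u ∈ R × CycAdj v u
  rimDominator v with S-tds (suc v)
  ... | suc u , there u∈R , v~u = u , u∈R , rim-adj⇒CycAdj v~u

  dominates : ∀ v → CycAdj v (proj₁ (rimDominator v))
  dominates v = proj₂ (proj₂ (rimDominator v))

  -- u ∈ R dominates only its two cycle neighbours, so tagging the dominator of v with the
  -- side it lies on gives an injection into two copies of R.
  side : ∀ {v u} → CycAdj v u → Fin (suc m) ⊎ Fin (suc m)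
  side {u = u} (inj₁ _) = inj₁ u
  side {u = u} (inj₂ _) = inj₂ u

  side-injective : ∀ {v w u u'} (a : CycAdj v u) (b : CycAdj w u') → side a ≡ side b → v ≡ w
  side-injective (inj₁ vu) (inj₁ wu) refl = cycNext-injective (trans vu (sym wu))
  side-injective (inj₂ uv) (inj₂ uw) refl = trans (sym uv) uw

  join-side∈R++R : ∀ {v u} → u ∈ R → (a : CycAdj v u) → join _ _ (side a) ∈ R ++ R
  join-side∈R++R u∈R (inj₁ _) = x∈p⇒x↑ˡ∈p++q R u∈R
  join-side∈R++R u∈R (inj₂ _) = y∈q⇒a↑ʳy∈p++q R u∈R

  code : Fin (suc m) → Fin (suc m + suc m)
  code v = join _ _ (side (dominates v))

  code∈R++R : ∀ v → code v ∈ R ++ R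
  code∈R++R v = join-side∈R++R (proj₁ (proj₂ (rimDominator v))) (dominates v)

  code-injective : Injective _≡_ _≡_ code
  code-injective {v} {w} eq = side-injective (dominates v) (dominates w)
    (trans (sym (splitAt-join _ _ _)) (trans (cong (splitAt _) eq) (splitAt-join _ _ _)))

k*3≤s+s⇒k<s : ∀ {k s} → 1 ≤ k → k * 3 ≤ s + s → k < s
k*3≤s+s⇒k<s {k} {s} 1≤k 3k≤2s = ≰⇒> λ s≤k → <⇒≱ 2k<3k (≤-trans 3k≤2s (+-mono-≤ s≤k s≤k))
  where
  2k<3k : k + k < k * 3
  2k<3k = subst (k + k <_) (*-comm 3 k)
    (+-monoʳ-< k (m<m+n k (subst (1 ≤_) (sym (+-identityʳ k)) 1≤k)))

-- The spokes deleted for the upper bound: those at the rim vertices 0, 3, …, 3(k − 1)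

everyThird : ℕ → (r : ℕ) → Subset r
everyThird zero r = ⊥
everyThird (suc k) (suc (suc (suc r))) = inside ∷ outside ∷ outside ∷ everyThird k r
everyThird (suc k) _ = ⊥

∣everyThird∣ : ∀ {k r} → k * 3 ≤ r → ∣ everyThird k r ∣ ≡ k
∣everyThird∣ {zero} {r} _ = ∣⊥∣≡0 r
∣everyThird∣ {suc k} (s≤s (s≤s (s≤s 3k≤r))) = cong suc (∣everyThird∣ 3k≤r)

everyThird-∋ : ∀ {k r} (i : Fin k) (v : Fin r) → k * 3 ≤ r → toℕ v ≡ toℕ i * 3 → v ∈ everyThird k r
everyThird-∋ zero zero (s≤s (s≤s (s≤s _))) _ = here
everyThird-∋ (suc i) (suc (suc (suc v))) (s≤s (s≤s (s≤s 3k≤r))) eq =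
  there (there (there
    (everyThird-∋ i v 3k≤r (ℕ.suc-injective (ℕ.suc-injective (ℕ.suc-injective eq))))))
everyThird-∋ zero (suc _) (s≤s (s≤s (s≤s _))) ()
everyThird-∋ (suc _) zero (s≤s (s≤s (s≤s _))) ()
everyThird-∋ (suc _) (suc zero) (s≤s (s≤s (s≤s _))) ()
everyThird-∋ (suc _) (suc (suc zero)) (s≤s (s≤s (s≤s _))) ()

3i+2<n : ∀ {k n} → k * 3 ≤ n → (i : Fin k) → suc (suc (toℕ i * 3)) < n
3i+2<n 3k≤n i = ≤-trans (*-monoˡ-≤ 3 (toℕ<n i)) 3k≤n

third : ∀ {k n} → k * 3 ≤ n → Fin k → Fin n
third 3k≤n i = fromℕ< (m+n≤o⇒n≤o 2 (3i+2<n 3k≤n i))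

third-injective : ∀ {k n} (3k≤n : k * 3 ≤ n) → Injective _≡_ _≡_ (third {k} 3k≤n)
third-injective 3k≤n {i} {j} eq = toℕ-injective (*-cancelʳ-≡ (toℕ i) (toℕ j) 3
  (trans (sym (toℕ-fromℕ< _)) (trans (cong toℕ eq) (toℕ-fromℕ< (m+n≤o⇒n≤o 2 (3i+2<n 3k≤n j))))))

cycNext²-third : ∀ {k m} (3k≤n : k * 3 ≤ suc m) (i : Fin k) →
                 cycNext (cycNext (third 3k≤n i)) ≡ fromℕ< (3i+2<n 3k≤n i)
cycNext²-third 3k≤n i = trans (cong cycNext (cycNext-fromℕ< 3i<m)) (cycNext-fromℕ< 3i+1<m)
  where
  3i+1<m = s≤s⁻¹ (3i+2<n 3k≤n i)
  3i<m = m+n≤o⇒n≤o 1 3i+1<m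

third-spread : ∀ {k m} (3k≤n : k * 3 ≤ suc m) (i j : Fin k) →
               cycNext (cycNext (third 3k≤n i)) ≢ third 3k≤n j
third-spread 3k≤n i j eq = 1+n≢0 (begin
  2                              ≡⟨ [m+kn]%n≡m%n 2 (toℕ i) 3 ⟨
  suc (suc (toℕ i * 3)) % 3      ≡⟨ cong (_% 3) (toℕ-fromℕ< (3i+2<n 3k≤n i)) ⟨
  toℕ (fromℕ< (3i+2<n 3k≤n i)) % 3 ≡⟨ cong (λ t → toℕ t % 3) (trans (sym (cycNext²-third 3k≤n i)) eq) ⟩
  toℕ (third 3k≤n j) % 3         ≡⟨ cong (_% 3) (toℕ-fromℕ< (m+n≤o⇒n≤o 2 (3i+2<n 3k≤n j))) ⟩
  toℕ j * 3 % 3                  ≡⟨ m*n%n≡0 (toℕ j) 3 ⟩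
  0                              ∎)
  where open ≡-Reasoning

thirdSpokes : ℕ → (n : ℕ) → Subset (n + n)
thirdSpokes k n = everyThird k n ++ ⊥

∣thirdSpokes∣ : ∀ {k n} → k * 3 ≤ n → ∣ thirdSpokes k n ∣ ≡ k
∣thirdSpokes∣ {k} {n} 3k≤n = begin
  ∣ everyThird k n ++ ⊥ ∣        ≡⟨ ∣p++q∣≡∣p∣+∣q∣ (everyThird k n) ⊥ ⟩
  ∣ everyThird k n ∣ + ∣ ⊥ {n} ∣  ≡⟨ cong₂ _+_ (∣everyThird∣ 3k≤n) (∣⊥∣≡0 n) ⟩
  k + 0                          ≡⟨ +-identityʳ k ⟩
  k                              ∎
  where open ≡-Reasoning

rim∉thirdSpokes : ∀ {k n} (i : Fin n) → rim i ∉ thirdSpokes k n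
rim∉thirdSpokes {k} {n} i = ∉⊥ ∘ a↑ʳy∈p++q⇒y∈q (everyThird k n)

third∈thirdSpokes : ∀ {k n} (3k≤n : k * 3 ≤ n) (i : Fin k) → spoke (third 3k≤n i) ∈ thirdSpokes k n
third∈thirdSpokes 3k≤n i = x∈p⇒x↑ˡ∈p++q ⊥ (everyThird-∋ i _ 3k≤n (toℕ-fromℕ< _))

thirdSpokes-γt> : ∀ {k m} → 1 ≤ k → k * 3 ≤ suc m →
                  TotalDomAtLeast (wheel (suc m)) (thirdSpokes k (suc m)) (suc k)
thirdSpokes-γt> {k} 1≤k 3k≤n S S-tds with zero ∈? S
... | yes hub∈S = hub∈tds⇒k<∣S∣ (third 3k≤n) (third-injective 3k≤n) (third-spread 3k≤n)
                    (third∈thirdSpokes 3k≤n) hub∈S S-tds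
... | no hub∉S = k*3≤s+s⇒k<s 1≤k (≤-trans 3k≤n (hub∉tds⇒n≤2∣S∣ hub∉S S-tds))

-- Small deletions leave a small total dominating set

atMost-mono : ∀ {G D b c} → b ≤ c → TotalDomAtMost G D b → TotalDomAtMost G D c
atMost-mono b≤c (S , S-tds , ∣S∣≤b) = S , S-tds , ≤-trans ∣S∣≤b b≤c

hub+image⇒γt≤ : ∀ {n D} (w : Fin (n + n) → Fin (suc n)) →
                TotalDominating (wheel n) D (⁅ zero ⁆ ∪ image w D) →
                TotalDomAtMost (wheel n) D (suc ∣ D ∣)
hub+image⇒γt≤ {D = D} w S-tds =
  _ , S-tds , ≤-trans (∣⁅x⁆∪p∣≤1+∣p∣ zero (image w D)) (s≤s (∣image∣≤∣p∣ w D))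

hub∈hub+image : ∀ {n} (w : Fin (n + n) → Fin (suc n)) D → zero ∈ ⁅ zero ⁆ ∪ image w D
hub∈hub+image w D = p⊆p∪q (image w D) (x∈⁅x⁆ zero)

image∈hub+image : ∀ {n} (w : Fin (n + n) → Fin (suc n)) D {e y} → w e ≡ y → e ∈ D →
                  y ∈ ⁅ zero ⁆ ∪ image w D
image∈hub+image w D refl e∈D = q⊆p∪q ⁅ zero ⁆ (image w D) (x∈p⇒fx∈image w D e∈D)

-- Rim vertices whose spoke is deleted are dominated by their chosen neighbour, the others by
-- the hub; the deleted rim edge pays for a rim vertex dominating the hub.
rim-deleted⇒γt≤ : ∀ {n D} {x j : Fin n} → NoIsolated (wheel n) D → spoke x ∉ D → rim j ∈ D →
                  TotalDomAtMost (wheel n) D (suc ∣ D ∣)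
rim-deleted⇒γt≤ {n} {D} {x} {j} noIsolated x∉D j∈D = hub+image⇒γt≤ w S-tds
  where
  w : Fin (n + n) → Fin (suc n)
  w = onEdges (λ v → proj₁ (noIsolated (suc v))) (λ _ → suc x)

  S-tds : TotalDominating (wheel n) D (⁅ zero ⁆ ∪ image w D)
  S-tds zero = suc x , image∈hub+image w D (onEdges-rim _ _ j) j∈D , spoke-adj x∉D
  S-tds (suc v) with spoke v ∈? D
  ... | yes v∈D = proj₁ (noIsolated (suc v)) ,
                  image∈hub+image w D (onEdges-spoke _ _ v) v∈D ,
                  proj₂ (noIsolated (suc v))
  ... | no v∉D = zero , hub∈hub+image w D , adj-sym (spoke-adj v∉D)

-- With all rim edges present, each rim vertex without spoke is dominated by its successor.
spoke-boundary⇒γt≤ : ∀ {n D} {v : Fin n} → (∀ i → rim i ∉ D) → spoke v ∈ D → spoke (cycNext v) ∉ D →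
                     TotalDomAtMost (wheel n) D (suc ∣ D ∣)
spoke-boundary⇒γt≤ {n} {D} {v} rims∉D v∈D next∉D = hub+image⇒γt≤ w S-tds
  where
  w : Fin (n + n) → Fin (suc n)
  w = onEdges (λ u → suc (cycNext u)) (λ _ → zero)

  S-tds : TotalDominating (wheel n) D (⁅ zero ⁆ ∪ image w D)
  S-tds zero = suc (cycNext v) , image∈hub+image w D (onEdges-spoke _ _ v) v∈D ,
               spoke-adj next∉D
  S-tds (suc u) with spoke u ∈? D
  ... | yes u∈D = suc (cycNext u) , image∈hub+image w D (onEdges-spoke _ _ u) u∈D ,
                  rim-adj (rims∉D u)
  ... | no u∉D = zero , hub∈hub+image w D , adj-sym (spoke-adj u∉D)

small-deletion⇒γt≤ : ∀ {m D} → NoIsolated (wheel (suc m)) D → ∣ D ∣ < suc m →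
                     TotalDomAtMost (wheel (suc m)) D (2 ⊔ suc ∣ D ∣)
small-deletion⇒γt≤ {m} {D} noIsolated ∣D∣<n with ∣D∣<n⇒spoke∉D ∣D∣<n
... | x , x∉D with any? (λ j → rim j ∈? D)
...   | yes (j , j∈D) = atMost-mono (m≤n⊔m 2 (suc ∣ D ∣)) (rim-deleted⇒γt≤ noIsolated x∉D j∈D)
...   | no noRim with any? (λ a → spoke a ∈? D)
...     | no noSpoke =
  atMost-mono (m≤m⊔n 2 (suc ∣ D ∣)) (spokes-intact⇒γt≤2 (λ a a∈D → noSpoke (a , a∈D)) x)
...     | yes (a , a∈D) with cycle-boundary (λ u → spoke u ∈? D) a∈D x∉D
...       | v , v∈D , next∉D =
  atMost-mono (m≤n⊔m 2 (suc ∣ D ∣)) (spoke-boundary⇒γt≤ (λ j j∈D → noRim (j , j∈D)) v∈D next∉D)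

wheel-bondage-lower : ∀ {m k D} → 2 ≤ k → k ≤ suc m → NoIsolated (wheel (suc m)) D →
                      TotalDomAtLeast (wheel (suc m)) D (suc k) → k ≤ ∣ D ∣
wheel-bondage-lower 2≤k k≤n noIsolated large = ≮⇒≥ λ ∣D∣<k → atLeast⇒¬atMost large
  (atMost-mono (⊔-lub 2≤k ∣D∣<k) (small-deletion⇒γt≤ noIsolated (<-≤-trans ∣D∣<k k≤n)))

theorem3p9 : (k n : ℕ) → 2 ≤ k → 3 * k ≤ n → IsKTotalBondage (wheel n) (k ∸ 1) k
theorem3p9 0 _ () _
theorem3p9 1 _ (s≤s ()) _
theorem3p9 (suc (suc _)) 0 _ ()
theorem3p9 (suc (suc _)) 1 _ (s≤s ())
theorem3p9 k@(suc (suc _)) n@(suc (suc _)) 2≤k 3k≤n =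
  2 , wheel-γt≡2 (s≤s z≤n)
    , (thirdSpokes k n , ∣thirdSpokes∣ {k} k*3≤n , noIsolated , thirdSpokes-γt> {k} (s≤s z≤n) k*3≤n)
    , λ _ → wheel-bondage-lower 2≤k (<⇒≤ k<n)
  where
  k*3≤n : k * 3 ≤ n
  k*3≤n = subst (_≤ n) (*-comm 3 k) 3k≤n
  k<n : k < n
  k<n = <-≤-trans (m<m*n k 3 (s≤s (s≤s z≤n))) k*3≤n
  noIsolated : NoIsolated (wheel n) (thirdSpokes k n)
  noIsolated = rims-intact⇒noIsolated (rim∉thirdSpokes {k})
                 (subst (_< n) (sym (∣thirdSpokes∣ {k} k*3≤n)) k<n)
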